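{- Let $\mathcal{L}$ be a conditional oriented matroid on a finite ground set $\mathcal{I}$, let $\mathcal{J}\subset\mathcal{I}$, and let $U$ be any signed set on the ground set $\mathcal{J}$. If $\mathcal{J}$ does not contain the support of any circuit of $\mathcal{L}$, then there exists a covector $Y\in\mathcal{L}$ with $Y_j=U_j$ for all $j\in\mathcal{J}$.
   Context: Signed sets $X=(X^+,X^-)$ (disjoint subsets), support $\underline{X}$, $X_j\in\{+,-,0\}$, $-X=(X^-,X^+)$, $\operatorname{Sep}(X,Y)=\{j\mid X_j=-Y_j\ne0\}$, $(X\circ Y)_j=X_j$ if $X_j\ne0$ else $Y_j$. A conditional oriented matroid is a (possibly empty) set $\mathcal{L}$ of signed sets (covectors) with (FS) $X,Y\in\mathcal{L}\Rightarrow X\circ-Y\in\mathcal{L}$ and (SE) for $X,Y\in\mathcal{L}$, $j\in\operatorname{Sep}(X,Y)$ there is $Z\in\mathcal{L}$ with $Z_j=0$ and $Z_k=(X\circ Y)_k$ for $k\notin\operatorname{Sep}(X,Y)$. A circuit is a signed set $X$ with $X\circ Y\ne Y$ for all $Y\in\mathcal{L}$, support-minimal with this property. -}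

module Defs where

open import Data.Nat using (ℕ)
open import Data.Fin using (Fin)
open import Data.Bool using (Bool; true; false)
open import Data.List using (List)
open import Data.List.Membership.Propositional using (_∈_)
open import Data.Product using (_×_; ∃)
open import Relation.Nullary using (¬_)
open import Relation.Binary.PropositionalEquality using (_≡_; _≢_)

data Sign : Set where
  plus minus zero : Sign

neg : Sign → Sign
neg plus  = minus
neg minus = plus
neg zero  = zero

-- A signed set on the ground set Fin n, given by its sign vector
-- (X⁺ = {j | X j ≡ plus}, X⁻ = {j | X j ≡ minus}; these are disjoint).
SignedSet : ℕ → Set
SignedSet n = Fin n → Sign

_∈supp_ : ∀ {n} → Fin n → SignedSet n → Set
j ∈supp X = X j ≢ zero

-op : ∀ {n} → SignedSet n → SignedSet n
-op X j = neg (X j)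

_∘s_ : ∀ {n} → SignedSet n → SignedSet n → SignedSet n
(X ∘s Y) j with X j
... | zero = Y j
... | s    = s

_≈s_ : ∀ {n} → SignedSet n → SignedSet n → Set
X ≈s Y = ∀ j → X j ≡ Y j

_∈Sep_,_ : ∀ {n} → Fin n → SignedSet n → SignedSet n → Set
j ∈Sep X , Y = (X j ≡ neg (Y j)) × (X j ≢ zero)

Covectors : ℕ → Set
Covectors n = List (SignedSet n)

FaceSymmetry : ∀ {n} → Covectors n → Set
FaceSymmetry L = ∀ {X Y} → X ∈ L → Y ∈ L → ∃ λ W → W ∈ L × W ≈s (X ∘s -op Y)

StrongElimination : ∀ {n} → Covectors n → Set
StrongElimination {n} L =
  ∀ {X Y} → X ∈ L → Y ∈ L → (j : Fin n) → j ∈Sep X , Y →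
  ∃ λ Z → Z ∈ L × (Z j ≡ zero) ×
    (∀ k → ¬ (k ∈Sep X , Y) → Z k ≡ (X ∘s Y) k)

record IsCOM {n : ℕ} (L : Covectors n) : Set where
  field
    fs : FaceSymmetry L
    se : StrongElimination L

AvoidsL : ∀ {n} → Covectors n → SignedSet n → Set
AvoidsL L X = ∀ {Y} → Y ∈ L → ¬ ((X ∘s Y) ≈s Y)

_⊂supp_ : ∀ {n} → SignedSet n → SignedSet n → Set
Z ⊂supp X = (∀ j → j ∈supp Z → j ∈supp X) × ∃ λ j → j ∈supp X × ¬ (j ∈supp Z)

IsCircuit : ∀ {n} → Covectors n → SignedSet n → Set
IsCircuit L X = AvoidsL L X × (∀ Z → Z ⊂supp X → ¬ AvoidsL L Z)

Subset : ℕ → Set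
Subset n = Fin n → Bool

_∈J_ : ∀ {n} → Fin n → Subset n → Set
j ∈J J = J j ≡ true

{-# OPTIONS --safe #-}
module Submission where

-- A signed set X with X ∘ Y ≠ Y for all covectors Y contains, by support
-- minimality, a circuit with support inside that of X. So when J contains no
-- circuit support, the restriction of U to J is extended by some covector,
-- which settles the case where U has no zeros on J. A zero of U at i ∈ J is
-- removed by realising U with U_i set to + and to −, and eliminating i between
-- the two covectors: the result vanishes at i and agrees with both elsewhere.

open import Defs
open import Data.Nat using (ℕ)
open import Data.Fin using (Fin)
open import Data.Product using (∃; _×_)
open import Data.List.Membership.Propositional using (_∈_)
open import Relation.Nullary using (¬_)
open import Relation.Binary.PropositionalEquality using (_≡_)

open import Data.Bool using (true; false)
open import Data.Empty using (⊥-elim)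
open import Data.Fin using (_≟_)
import Data.Fin.Properties as Fin
import Data.Fin.Subset as Sub
open import Data.Fin.Subset.Induction using (⊂-wellFounded)
open import Data.List using (List; []; _∷_; allFin)
open import Data.List.Membership.Propositional using (find; lose)
open import Data.List.Membership.Propositional.Properties using (∈-allFin)
open import Data.List.Relation.Unary.Any using (here; there; any?)
open import Data.Product using (_,_)
open import Data.Vec using (tabulate)
open import Data.Vec.Properties using (lookup∘tabulate; lookup⇒[]=; []=⇒lookup)
open import Data.Vec.Functional using (updateAt)
open import Data.Vec.Functional.Properties using (updateAt-updates; updateAt-minimal)
open import Function using (const; case_of_; _∘_)
open import Induction.WellFounded using (WellFounded; Acc; acc; module Subrelation)
import Relation.Binary.Construct.On as On
open import Relation.Binary.PropositionalEquality using (_≢_; refl; sym; trans; cong; module ≡-Reasoning)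
open import Relation.Nullary using (Dec; yes; no)

_≟ˢ_ : (a b : Sign) → Dec (a ≡ b)
plus  ≟ˢ plus  = yes refl
plus  ≟ˢ minus = no λ ()
plus  ≟ˢ zero  = no λ ()
minus ≟ˢ plus  = no λ ()
minus ≟ˢ minus = yes refl
minus ≟ˢ zero  = no λ ()
zero  ≟ˢ plus  = no λ ()
zero  ≟ˢ minus = no λ ()
zero  ≟ˢ zero  = yes refl

neg-fixed⇒zero : ∀ {a} → a ≡ neg a → a ≡ zero
neg-fixed⇒zero {zero} _ = refl

∘s-nonzero : ∀ {n} (X Y : SignedSet n) j → j ∈supp X → (X ∘s Y) j ≡ X j
∘s-nonzero X Y j j∈X with X j
... | plus  = refl
... | minus = refl
... | zero  = ⊥-elim (j∈X refl)

∘s-agree : ∀ {n} (X Y : SignedSet n) j → X j ≡ Y j → (X ∘s Y) j ≡ X j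
∘s-agree X Y j Xj≡Yj with X j
... | plus  = refl
... | minus = refl
... | zero  = sym Xj≡Yj

side : Sign → Sub.Side
side zero = Sub.outside
side _    = Sub.inside

support : ∀ {n} → SignedSet n → Sub.Subset n
support X = tabulate (λ j → side (X j))

∈supp⇒∈support : ∀ {n} {X : SignedSet n} {j} → j ∈supp X → j Sub.∈ support X
∈supp⇒∈support {X = X} {j} j∈X = lookup⇒[]= j _ (trans (lookup∘tabulate _ j) (inside-side (X j) j∈X))
  where
  inside-side : ∀ s → s ≢ zero → side s ≡ Sub.inside
  inside-side plus  _ = refl
  inside-side minus _ = refl
  inside-side zero  s≢0 = ⊥-elim (s≢0 refl)

∈support⇒∈supp : ∀ {n} {X : SignedSet n} {j} → j Sub.∈ support X → j ∈supp X
∈support⇒∈supp {X = X} {j} j∈X Xj≡0 with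
  trans (cong side (sym Xj≡0)) (trans (sym (lookup∘tabulate _ j)) ([]=⇒lookup j∈X))
... | ()

⊂supp⇒support⊂ : ∀ {n} {Z X : SignedSet n} → Z ⊂supp X → support Z Sub.⊂ support X
⊂supp⇒support⊂ (Z⊆X , j , j∈X , j∉Z) =
  (λ j∈Z → ∈supp⇒∈support (Z⊆X _ (∈support⇒∈supp j∈Z))) ,
  j , ∈supp⇒∈support j∈X , λ j∈Z → j∉Z (∈support⇒∈supp j∈Z)

⊂supp-wellFounded : ∀ {n} → WellFounded (_⊂supp_ {n})
⊂supp-wellFounded = Subrelation.wellFounded ⊂supp⇒support⊂ (On.wellFounded support ⊂-wellFounded)

module _ {n : ℕ} (L : Covectors n) where

  ¬avoids⇒extended : ∀ X → ¬ AvoidsL L X → ∃ λ Y → Y ∈ L × (X ∘s Y) ≈s Y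
  ¬avoids⇒extended X ¬avoids with any? (λ Y → Fin.all? (λ j → (X ∘s Y) j ≟ˢ Y j)) L
  ... | yes extended = find extended
  ... | no ¬extended = ⊥-elim (¬avoids λ Y∈L X∘Y≈Y → ¬extended (lose Y∈L X∘Y≈Y))

  circuit-free⇒¬avoids : (J : Subset n) → (∀ C → IsCircuit L C → ¬ (∀ j → j ∈supp C → j ∈J J))
    → ∀ X → Acc _⊂supp_ X → (∀ j → j ∈supp X → j ∈J J) → ¬ AvoidsL L X
  circuit-free⇒¬avoids J circuit-free X (acc rs) X⊆J avoids =
    circuit-free X (avoids , minimal) X⊆J
    where
    minimal : ∀ Z → Z ⊂supp X → ¬ AvoidsL L Z
    minimal Z Z⊂X@(Z⊆X , _) =
      circuit-free⇒¬avoids J circuit-free Z (rs Z⊂X) (λ j j∈Z → X⊆J j (Z⊆X j j∈Z))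

  eliminate-agreeing : StrongElimination L → ∀ {Y₁ Y₂} → Y₁ ∈ L → Y₂ ∈ L → ∀ i → i ∈Sep Y₁ , Y₂
    → ∃ λ Z → Z ∈ L × Z i ≡ zero × (∀ k → Y₁ k ≡ Y₂ k → Z k ≡ Y₁ k)
  eliminate-agreeing se {Y₁} {Y₂} Y₁∈L Y₂∈L i i∈Sep with se Y₁∈L Y₂∈L i i∈Sep
  ... | Z , Z∈L , Zi≡0 , Z≡Y₁∘Y₂ = Z , Z∈L , Zi≡0 , λ k agree →
    trans (Z≡Y₁∘Y₂ k (not-separated k agree)) (∘s-agree Y₁ Y₂ k agree)
    where
    not-separated : ∀ k → Y₁ k ≡ Y₂ k → ¬ (k ∈Sep Y₁ , Y₂)
    not-separated k agree (Y₁k≡-Y₂k , k∈Y₁) =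
      k∈Y₁ (neg-fixed⇒zero (trans Y₁k≡-Y₂k (cong neg (sym agree))))

restrict : ∀ {n} → Subset n → SignedSet n → SignedSet n
restrict J U j with J j
... | true  = U j
... | false = zero

restrict-⊆ : ∀ {n} (J : Subset n) U j → j ∈supp restrict J U → j ∈J J
restrict-⊆ J U j j∈supp with J j
... | true  = refl
... | false = ⊥-elim (j∈supp refl)

restrict-on : ∀ {n} (J : Subset n) U {j} → j ∈J J → restrict J U j ≡ U j
restrict-on J U j∈J rewrite j∈J = refl

module _ {n : ℕ} (L : Covectors n) (se : StrongElimination L) (J : Subset n)
  (circuit-free : ∀ X → IsCircuit L X → ¬ (∀ j → j ∈supp X → j ∈J J)) where

  open ≡-Reasoning

  Realisable : SignedSet n → Set
  Realisable U = ∃ λ Y → Y ∈ L × (∀ j → j ∈J J → Y j ≡ U j)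

  realise-nonzero : ∀ U → (∀ j → j ∈J J → U j ≢ zero) → Realisable U
  realise-nonzero U U≢0 with ¬avoids⇒extended L (restrict J U)
    (circuit-free⇒¬avoids L J circuit-free (restrict J U) (⊂supp-wellFounded _) (restrict-⊆ J U))
  ... | Y , Y∈L , U∘Y≈Y = Y , Y∈L , agree
    where
    agree : ∀ j → j ∈J J → Y j ≡ U j
    agree j j∈J = begin
      Y j                     ≡⟨ sym (U∘Y≈Y j) ⟩
      (restrict J U ∘s Y) j   ≡⟨ ∘s-nonzero (restrict J U) Y j (λ Uj≡0 → U≢0 j j∈J (trans (sym (restrict-on J U j∈J)) Uj≡0)) ⟩
      restrict J U j          ≡⟨ restrict-on J U j∈J ⟩
      U j                     ∎

  _[_]≔_ : SignedSet n → Fin n → Sign → SignedSet n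
  U [ i ]≔ s = updateAt U i (const s)

  fill-zero : ∀ U i → i ∈J J → U i ≡ zero
    → Realisable (U [ i ]≔ plus) → Realisable (U [ i ]≔ minus) → Realisable U
  fill-zero U i i∈J Ui≡0 (Y₁ , Y₁∈L , Y₁≡U⁺) (Y₂ , Y₂∈L , Y₂≡U⁻)
    with eliminate-agreeing L se Y₁∈L Y₂∈L i i∈Sep
    where
    Y₁i≡+ : Y₁ i ≡ plus
    Y₁i≡+ = trans (Y₁≡U⁺ i i∈J) (updateAt-updates i U)
    Y₂i≡- : Y₂ i ≡ minus
    Y₂i≡- = trans (Y₂≡U⁻ i i∈J) (updateAt-updates i U)
    i∈Sep : i ∈Sep Y₁ , Y₂
    i∈Sep = trans Y₁i≡+ (cong neg (sym Y₂i≡-)) , λ Y₁i≡0 → case trans (sym Y₁i≡+) Y₁i≡0 of λ ()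
  ... | Z , Z∈L , Zi≡0 , Z≡Y₁ = Z , Z∈L , agree
    where
    agree : ∀ j → j ∈J J → Z j ≡ U j
    agree j j∈J with j ≟ i
    ... | yes refl = trans Zi≡0 (sym Ui≡0)
    ... | no j≢i = trans (Z≡Y₁ j (trans Y₁j≡Uj (sym Y₂j≡Uj))) Y₁j≡Uj
      where
      Y₁j≡Uj : Y₁ j ≡ U j
      Y₁j≡Uj = trans (Y₁≡U⁺ j j∈J) (updateAt-minimal j i U j≢i)
      Y₂j≡Uj : Y₂ j ≡ U j
      Y₂j≡Uj = trans (Y₂≡U⁻ j j∈J) (updateAt-minimal j i U j≢i)

  ZerosWithin : SignedSet n → List (Fin n) → Set
  ZerosWithin U zs = ∀ j → j ∈J J → U j ≡ zero → j ∈ zs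

  zerosWithin-tail : ∀ {U i zs} → ZerosWithin U (i ∷ zs) → ∀ V
    → (i ∈J J → V i ≢ zero) → (∀ j → j ≢ i → V j ≡ U j) → ZerosWithin V zs
  zerosWithin-tail {i = i} U-zeros V Vi≢0 V≡U j j∈J Vj≡0 with j ≟ i
  ... | yes refl = ⊥-elim (Vi≢0 j∈J Vj≡0)
  ... | no j≢i with U-zeros j j∈J (trans (sym (V≡U j j≢i)) Vj≡0)
  ...   | here j≡i   = ⊥-elim (j≢i j≡i)
  ...   | there j∈zs = j∈zs

  fill-zeros : ∀ zs U → ZerosWithin U zs → Realisable U
  fill-zeros []       U U-zeros = realise-nonzero U λ j j∈J Uj≡0 → case U-zeros j j∈J Uj≡0 of λ ()
  fill-zeros (i ∷ zs) U U-zeros with U i ≟ˢ zero | J i in Ji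
  ... | no Ui≢0  | _     = fill-zeros zs U (zerosWithin-tail U-zeros U (const Ui≢0) λ _ _ → refl)
  ... | yes Ui≡0 | false = fill-zeros zs U (zerosWithin-tail U-zeros U (λ i∈J → case trans (sym i∈J) Ji of λ ()) λ _ _ → refl)
  ... | yes Ui≡0 | true  = fill-zero U i Ji Ui≡0 (fill-zeros zs _ (set-zerosWithin λ ())) (fill-zeros zs _ (set-zerosWithin λ ()))
    where
    set-zerosWithin : ∀ {s} → s ≢ zero → ZerosWithin (U [ i ]≔ s) zs
    set-zerosWithin {s} s≢0 = zerosWithin-tail U-zeros (U [ i ]≔ s)
      (λ _ → s≢0 ∘ trans (sym (updateAt-updates i U))) λ j j≢i → updateAt-minimal j i U j≢i

lemma4p13 : (n : ℕ) (L : Covectors n) → IsCOM L → (J : Subset n) → (U : SignedSet n)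
    → (∀ X → IsCircuit L X → ¬ (∀ j → j ∈supp X → j ∈J J))
    → ∃ λ Y → Y ∈ L × (∀ j → j ∈J J → Y j ≡ U j)
lemma4p13 n L com J U circuit-free =
  fill-zeros L (IsCOM.se com) J circuit-free (allFin n) U λ j _ _ → ∈-allFin j
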